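{- If $(u,v)\in L\times L$ satisfies condition $(\star)$, then both $(u0,v0)$ and $(u1,v1)$ satisfy condition $(\star)$.
   Context: Words are over the alphabet $\{0,1\}$. For finite words $u,v$, $\binom{u}{v}$ is the number of times $v$ occurs as a (not necessarily contiguous) subsequence of $u$; $\binom{u}{\varepsilon}=1$. Let $L=\{\varepsilon\}\cup 1\{0,1\}^*$. A pair $(u,v)\in L\times L$ satisfies condition $(\star)$ if $(u,v)\neq(\varepsilon,\varepsilon)$, $\binom{u}{v}\equiv 1\bmod 2$, $\binom{u}{v0}=0$ and $\binom{u}{v1}=0$. -}

module Defs where

open import Data.Nat using (ℕ; zero; suc; _+_; _*_; _%_)
open import Data.List using (List; []; _∷_; _++_; [_])
open import Data.Product using (_×_; _,_)
open import Relation.Binary.PropositionalEquality using (_≡_; _≢_)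

data Bit : Set where
  b0 b1 : Bit

Word : Set
Word = List Bit

bitEq : Bit → Bit → ℕ
bitEq b0 b0 = 1
bitEq b1 b1 = 1
bitEq b0 b1 = 0
bitEq b1 b0 = 0

-- binom u v : number of occurrences of v as a (scattered) subsequence of u.
binom : Word → Word → ℕ
binom u [] = 1
binom [] (_ ∷ _) = 0
binom (a ∷ u) (b ∷ v) = binom u (b ∷ v) + bitEq a b * binom u v

data InL : Word → Set where
  L-ε : InL []
  L-1 : (w : Word) → InL (b1 ∷ w)

_·_ : Word → Bit → Word
w · a = w ++ [ a ]

-- condition (⋆) for a pair (u,v) (membership in L × L is a separate hypothesis)
Star : Word → Word → Set
Star u v = ((u , v) ≢ ([] , []))
         × (binom u v % 2 ≡ 1)
         × (binom u (v · b0) ≡ 0)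
         × (binom u (v · b1) ≡ 0)

{-# OPTIONS --safe #-}
module Submission where

open import Defs
open import Data.Nat using (ℕ; _+_; _*_; _%_)
open import Data.Nat.Properties using (m+n≡0⇒m≡0; m+n≡0⇒n≡0; m*n≡0⇒m≡0∨n≡0; *-zeroʳ; +-identityʳ)
open import Data.Nat.Tactic.RingSolver using (solve-∀)
open import Data.List using ([]; _∷_; _++_; [_])
open import Data.Product using (_×_; _,_)
open import Data.Sum using (inj₁; inj₂)
open import Relation.Binary.PropositionalEquality using (_≡_; _≢_; refl; sym; trans; cong; cong₂; module ≡-Reasoning)

-- Appending the same letter a to u and v: Pascal's rule at the last letter gives
-- binom (u a) (v a) = binom u (v a) + binom u v and
-- binom (u a) (v a c) = binom u (v a c) + [a = c] binom u (v a).
-- Since v a is not a subsequence of u, neither is its extension v a c, so the first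
-- identity preserves the parity and the second gives 0.

bitEq-refl : ∀ a → bitEq a a ≡ 1
bitEq-refl b0 = refl
bitEq-refl b1 = refl

binom-[]-· : ∀ w b → binom [] (w · b) ≡ 0
binom-[]-· []      b = refl
binom-[]-· (_ ∷ _) b = refl

binom-· : ∀ u w a b → binom (u · a) (w · b) ≡ binom u (w · b) + bitEq a b * binom u w
binom-· []      []      a b = refl
binom-· []      (c ∷ w) a b rewrite binom-[]-· w b = trans (*-zeroʳ (bitEq a c)) (sym (*-zeroʳ (bitEq a b)))
binom-· (x ∷ u) []      a b rewrite binom-· u [] a b = swap (binom u [ b ]) (bitEq a b) (bitEq x b)
  where
  swap : ∀ p q r → p + q * 1 + r * 1 ≡ p + r * 1 + q * 1
  swap = solve-∀
binom-· (x ∷ u) (c ∷ w) a b = begin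
  binom (u · a) (c ∷ w · b) + f * binom (u · a) (w · b)
    ≡⟨ cong₂ (λ s t → s + f * t) (binom-· u (c ∷ w) a b) (binom-· u w a b) ⟩
  (binom u (c ∷ w · b) + e * binom u (c ∷ w)) + f * (binom u (w · b) + e * binom u w)
    ≡⟨ regroup (binom u (c ∷ w · b)) e (binom u (c ∷ w)) f (binom u (w · b)) (binom u w) ⟩
  (binom u (c ∷ w · b) + f * binom u (w · b)) + e * (binom u (c ∷ w) + f * binom u w)
    ∎
  where
  open ≡-Reasoning
  e f : ℕ
  e = bitEq a b
  f = bitEq x c
  regroup : ∀ p e q f r s → p + e * q + f * (r + e * s) ≡ p + f * r + e * (q + f * s)
  regroup = solve-∀

binom-++-zero : ∀ u w z → binom u w ≡ 0 → binom u (w ++ z) ≡ 0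
binom-++-zero []      (_ ∷ _) z h = refl
binom-++-zero (x ∷ u) (c ∷ w) z h =
  cong₂ _+_ (binom-++-zero u (c ∷ w) z (m+n≡0⇒m≡0 _ h)) second
  where
  second : bitEq x c * binom u (w ++ z) ≡ 0
  second with m*n≡0⇒m≡0∨n≡0 (bitEq x c) (m+n≡0⇒n≡0 (binom u (c ∷ w)) h)
  ... | inj₁ x≢c = cong (_* binom u (w ++ z)) x≢c
  ... | inj₂ w∉u = trans (cong (bitEq x c *_) (binom-++-zero u w z w∉u)) (*-zeroʳ (bitEq x c))

Star-· : ∀ u v a → Star u v → Star (u · a) (v · a)
Star-· u v a (_ , odd , v0∉u , v1∉u) = nonempty u , odd′ , extension∉ b0 , extension∉ b1
  where
  v·∉u : ∀ b → binom u (v · b) ≡ 0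
  v·∉u b0 = v0∉u
  v·∉u b1 = v1∉u

  va∉u : binom u (v · a) ≡ 0
  va∉u = v·∉u a

  nonempty : ∀ w → (w · a , v · a) ≢ ([] , [])
  nonempty []      ()
  nonempty (_ ∷ _) ()

  odd′ : binom (u · a) (v · a) % 2 ≡ 1
  odd′ rewrite binom-· u v a a | va∉u | bitEq-refl a | +-identityʳ (binom u v) = odd

  extension∉ : ∀ c → binom (u · a) ((v · a) · c) ≡ 0
  extension∉ c rewrite binom-· u (v · a) a c | binom-++-zero u (v · a) [ c ] va∉u | va∉u =
    *-zeroʳ (bitEq a c)

mainTheorem3 : (u v : Word) → InL u → InL v → Star u v →
    Star (u · b0) (v · b0) × Star (u · b1) (v · b1)
mainTheorem3 u v _ _ s = Star-· u v b0 s , Star-· u v b1 s
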